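{- Let $\mathcal Z$ be a commutative associative unital $\mathbb Q$-algebra, $N\in\mathbb N$, $n\in[N]$ with $n\ge3$, $Z=(z_{j,r})\in\mathcal Z^{N\times n}$. Let $R\subseteq[n]$ with $|R|\le n-3$ and let $(r,s,t)\in([n]\setminus R)^3_{\neq}$. Then $$\sum_{j\in[N]^n_{\neq}}y_{j_r,j_s,r}\,y_{j_r,j_s,s}\big(p_{j,R\cup\{t\}}-\widetilde z_t\,p_{j,R}\big)=D_1-D_2,$$ where $$D_1=\frac2N\sum_{j\in[N]^n_{\neq}}y_{j_r,j_s,r}\,y_{j_r,j_s,s}\,y_{j_t,j_r,t}\,p_{j,R},\qquad D_2=\frac1{2N}\sum_{q\in R}\sum_{j\in[N]^n_{\neq}}y_{j_r,j_s,r}\,y_{j_r,j_s,s}\,y_{j_t,j_q,t}\,y_{j_t,j_q,q}\,p_{j,R\setminus\{q\}}.$$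
   Context: $[m]=\{1,\dots,m\}$. $[N]^n_{\neq}$ is the set of injective maps $j:[n]\to[N]$, written $(j_1,\dots,j_n)$; for a set $A$, $A^3_{\neq}$ is the set of triples of pairwise distinct elements of $A$. $\widetilde z_r=\frac1N\sum_{j=1}^Nz_{j,r}$, $y_{j,k,r}=z_{j,r}-z_{k,r}$. For $R\subseteq[n]$ and $j\in[N]^n_{\neq}$, $p_{j,R}=\prod_{\ell\in R}z_{j_\ell,\ell}$. Empty sums are $0$, empty products are $1$. -}

module Defs where

open import Level using (Level; _⊔_)
open import Data.Nat as ℕ using (ℕ; zero; suc)
open import Data.Integer using (+_)
open import Data.Rational as ℚ using (ℚ)
open import Data.Fin using (Fin; zero; suc)
open import Data.Fin.Properties using (all?) renaming (_≟_ to _≟ᶠ_)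
open import Data.Fin.Subset using (Subset)
open import Data.Fin.Subset.Properties using (_∈?_)
open import Data.Bool using (if_then_else_)
open import Function.Definitions using (Injective)
open import Relation.Binary.PropositionalEquality using (_≡_)
open import Relation.Nullary using (Dec; yes; no)
open import Relation.Nullary.Decidable using (map′; _→-dec_; does)
open import Algebra.Bundles using (CommutativeRing)
open import Algebra.Morphism.Structures using (IsRingHomomorphism)

record QAlgebra (c ℓ : Level) : Set (Level.suc (c ⊔ ℓ)) where
  field
    commRing : CommutativeRing c ℓ
  open CommutativeRing commRing public
  field
    ι     : ℚ → Carrier
    ι-hom : IsRingHomomorphism ℚ.+-*-rawRing rawRing ι

-- 1/N as a rational number (only used for N ≥ 3; value at 0 irrelevant).
recip : ℕ → ℚ
recip zero    = ℚ.0ℚ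
recip (suc m) = + 1 ℚ./ suc m

injective? : ∀ {n N} (j : Fin n → Fin N) → Dec (Injective _≡_ _≡_ j)
injective? j =
  map′ (λ h {x} {y} → h x y) (λ h x y → h {x} {y})
       (all? λ x → all? λ y → (j x ≟ᶠ j y) →-dec (x ≟ᶠ y))

module Ops {c ℓ} (A : QAlgebra c ℓ) where
  open QAlgebra A using (Carrier; _+_; _*_; _-_; 0#; 1#; ι)

  ∑ : ∀ {k} → (Fin k → Carrier) → Carrier
  ∑ {zero}  f = 0#
  ∑ {suc k} f = f zero + ∑ (λ i → f (suc i))

  ∏ : ∀ {k} → (Fin k → Carrier) → Carrier
  ∏ {zero}  f = 1#
  ∏ {suc k} f = f zero * ∏ (λ i → f (suc i))

  ∑map : ∀ {N} n → ((Fin n → Fin N) → Carrier) → Carrier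
  ∑map zero    f = f (λ ())
  ∑map (suc n) f = ∑ λ a → ∑map n (λ g → f λ { zero → a ; (suc i) → g i })

  ∑inj : ∀ {N} n → ((Fin n → Fin N) → Carrier) → Carrier
  ∑inj n f = ∑map n λ j → if does (injective? j) then f j else 0#

  ∑∈ : ∀ {n} → Subset n → (Fin n → Carrier) → Carrier
  ∑∈ R f = ∑ λ q → if does (q ∈? R) then f q else 0#

  module _ {N n : ℕ} (z : Fin N → Fin n → Carrier) where
    z~ : Fin n → Carrier
    z~ r = ι (recip N) * ∑ (λ j → z j r)

    y : Fin N → Fin N → Fin n → Carrier
    y j k r = z j r - z k r

    p : (Fin n → Fin N) → Subset n → Carrier
    p j R = ∏ λ l → if does (l ∈? R) then z (j l) l else 1#

-- Writing z_{j_t,t} − z̃_t as the mean over k ∈ [N] of y_{j_t,k,t} turns the left-hand side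
-- into (1/N) ∑_j ∑_k G(j,k) with G(j,k) = y_{j_r,j_s,r} y_{j_r,j_s,s} p_{j,R} y_{j_t,k,t}.
-- For injective j, split the inner sum into k = j_l (l ∈ [n]) and k outside the image of j.
-- The latter part is a sum over injective (n+1)-tuples (k, j) which changes sign when k and j_t
-- are exchanged, so it vanishes.  In the former, H_l = ∑_j G(j, j_l) is computed by transposing
-- coordinates of j: H_s = H_r (swap r, s), H_t = 0, H_l = 0 for l ∉ R ∪ {r,s,t} (swap t, l is
-- antisymmetric), and for q ∈ R averaging H_q with its image under the swap of t and q gives
-- H_q = −½ ∑_j y_{j_r,j_s,r} y_{j_r,j_s,s} y_{j_t,j_q,t} y_{j_t,j_q,q} p_{j,R∖{q}}.
-- Hence ∑_l H_l = 2 H_r − ½ ∑_{q ∈ R} (…), which is N (D₁ − D₂).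
module Submission where

open import Defs
open import Level using (Level)
open import Data.Nat as ℕ using (ℕ; zero; suc; _≤_; _∸_)
import Data.Nat.Properties as ℕP
open import Data.Nat.Coprimality using (1-coprimeTo) renaming (sym to coprime-sym)
open import Data.Integer as ℤ using (+_)
open import Data.Integer.Solver using (module +-*-Solver)
open import Data.Rational as ℚ using (ℚ; mkℚ; _/_)
import Data.Rational.Properties as ℚP
import Data.Rational.Unnormalised as ℚᵘ
import Data.Rational.Unnormalised.Properties as ℚᵘP
open import Data.Bool using (Bool; true; false; _∧_; not; if_then_else_)
open import Data.Empty using (⊥-elim)
open import Data.Maybe using (Maybe; nothing; just)
open import Data.Product using (∃; _×_; _,_)
open import Data.Sum using (inj₁; inj₂; [_,_]′)
open import Data.Fin using (Fin; zero; suc; punchIn)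
open import Data.Fin.Properties using (any?; suc-injective; punchInᵢ≢i; 0≢1+n) renaming (_≟_ to _≟ᶠ_)
open import Data.Fin.Permutation as Perm using (Permutation; _⟨$⟩ʳ_; _⟨$⟩ˡ_)
import Data.Fin.Permutation.Components as PC
open import Data.Fin.Subset using (Subset; _∈_; _∉_; _∪_; _─_; ⁅_⁆; ∣_∣; inside) renaming (_-_ to _-ₛ_)
open import Data.Fin.Subset.Properties
  using (_∈?_; x∈p∪q⁻; x∈p∪q⁺; x∈⁅x⁆; x∈⁅y⁆⇒x≡y; p─q⊆p; x∈p∧x≢y⇒x∈p-y)
import Data.Vec.Base as Vec
open import Data.Vec.Functional using (_∷_; head; tail; insertAt; removeAt)
open import Data.Vec.Functional.Properties using (insertAt-lookup; insertAt-punchIn)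
open import Function.Base using (_∘_)
open import Function.Bundles using (_⇔_; mk⇔)
open import Function.Definitions using (Injective)
open import Relation.Binary.PropositionalEquality as ≡ using (_≡_; _≢_; _≗_)
open import Relation.Nullary using (Dec; yes; no; does; ¬_; ¬?; _×-dec_)
open import Relation.Nullary.Decidable using (dec-true; dec-false; does-⇔)
open import Algebra.Morphism.Structures using (module IsRingHomomorphism)
open import Algebra.Solver.Ring.AlmostCommutativeRing using (fromCommutativeRing; _-Raw-AlmostCommutative⟶_)
import Algebra.Solver.Ring as RingSolver

natℚ : ℕ → ℚ
natℚ k = mkℚ (+ k) 0 (coprime-sym (1-coprimeTo k))

natℚ-suc : ∀ k → natℚ (suc k) ≡ ℚ.1ℚ ℚ.+ natℚ k
natℚ-suc k = ℚP.toℚᵘ-injective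
  (ℚᵘP.≃-trans (ℚᵘ.*≡* cross) (ℚᵘP.≃-sym (ℚP.toℚᵘ-homo-+ ℚ.1ℚ (natℚ k))))
  where
  open +-*-Solver
  cross : + suc k ℤ.* (+ 1 ℤ.* + 1) ≡ (+ 1 ℤ.* + 1 ℤ.+ + k ℤ.* + 1) ℤ.* + 1
  cross = solve 1 (λ x → (con (+ 1) :+ x) :* (con (+ 1) :* con (+ 1))
                      := (con (+ 1) :* con (+ 1) :+ x :* con (+ 1)) :* con (+ 1)) ≡.refl (+ k)

recip-inverseˡ : ∀ m → recip (suc m) ℚ.* natℚ (suc m) ≡ ℚ.1ℚ
recip-inverseˡ m = ≡.trans (≡.cong (ℚ._* natℚ (suc m)) (ℚP.normalize-coprime (1-coprimeTo (suc m))))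
                           (ℚP.*-inverseˡ (natℚ (suc m)))

transpose-matchˡ : ∀ {n} (a b : Fin n) → PC.transpose a b a ≡ b
transpose-matchˡ a b rewrite dec-true (a ≟ᶠ a) ≡.refl = ≡.refl

transpose-matchʳ : ∀ {n} (a b : Fin n) → PC.transpose a b b ≡ a
transpose-matchʳ a b with b ≟ᶠ a
... | yes b≡a = b≡a
... | no _ rewrite dec-true (b ≟ᶠ b) ≡.refl = ≡.refl

transpose-other : ∀ {n} {a b k : Fin n} → k ≢ a → k ≢ b → PC.transpose a b k ≡ k
transpose-other {a = a} {b} {k} k≢a k≢b rewrite dec-false (k ≟ᶠ a) k≢a | dec-false (k ≟ᶠ b) k≢b = ≡.refl

transpose-∉ : ∀ {n} {S : Subset n} {a b l} → a ∉ S → b ∉ S → l ∈ S → PC.transpose a b l ≡ l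
transpose-∉ {S = S} a∉S b∉S l∈S =
  transpose-other (λ l≡a → a∉S (≡.subst (_∈ S) l≡a l∈S))
                  (λ l≡b → b∉S (≡.subst (_∈ S) l≡b l∈S))

x∈p─q⇒x∉q : ∀ {n} {x : Fin n} (p q : Subset n) → x ∈ p ─ q → x ∉ q
x∈p─q⇒x∉q (_ Vec.∷ p) (_ Vec.∷ q) (Vec.there x∈p─q) (Vec.there x∈q) =
  x∈p─q⇒x∉q p q x∈p─q x∈q
x∈p─q⇒x∉q (_ Vec.∷ p) (inside Vec.∷ q) () Vec.here

x∈p-y⇒x≢y : ∀ {n} {x y : Fin n} (p : Subset n) → x ∈ p -ₛ y → x ≢ y
x∈p-y⇒x≢y {y = y} p x∈p-y ≡.refl = x∈p─q⇒x∉q p ⁅ y ⁆ x∈p-y (x∈⁅x⁆ y)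

insertAt-cong : ∀ {n} {A : Set} {g h : Fin n → A} (k : Fin (suc n)) (a : A) → g ≗ h →
                insertAt g k a ≗ insertAt h k a
insertAt-cong zero a g≗h zero = ≡.refl
insertAt-cong zero a g≗h (suc i) = g≗h i
insertAt-cong {suc n} (suc k) a g≗h zero = g≗h zero
insertAt-cong {suc n} (suc k) a g≗h (suc i) = insertAt-cong k a (g≗h ∘ suc) i

∈-image? : ∀ {n N} (j : Fin n → Fin N) (k : Fin N) → Dec (∃ λ i → j i ≡ k)
∈-image? j k = any? (λ i → j i ≟ᶠ k)

injective?-≗ : ∀ {n N} {g h : Fin n → Fin N} → g ≗ h → does (injective? g) ≡ does (injective? h)
injective?-≗ {g = g} {h} g≗h = does-⇔
  (mk⇔ (λ g-inj {x} {y} hx≡hy → g-inj (≡.trans (g≗h x) (≡.trans hx≡hy (≡.sym (g≗h y)))))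
       (λ h-inj {x} {y} gx≡gy → h-inj (≡.trans (≡.sym (g≗h x)) (≡.trans gx≡gy (g≗h y)))))
  (injective? g) (injective? h)

injective?-∘-permutation : ∀ {n N} (j : Fin n → Fin N) (π : Permutation n n) →
                           does (injective? (j ∘ (π ⟨$⟩ʳ_))) ≡ does (injective? j)
injective?-∘-permutation j π = does-⇔ (mk⇔ uncompose compose) (injective? (j ∘ πʳ)) (injective? j)
  where
  πʳ = π ⟨$⟩ʳ_
  πˡ = π ⟨$⟩ˡ_
  compose : Injective _≡_ _≡_ j → Injective _≡_ _≡_ (j ∘ πʳ)
  compose j-inj jπx≡jπy =
    ≡.trans (≡.sym (Perm.inverseˡ π)) (≡.trans (≡.cong πˡ (j-inj jπx≡jπy)) (Perm.inverseˡ π))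
  uncompose : Injective _≡_ _≡_ (j ∘ πʳ) → Injective _≡_ _≡_ j
  uncompose jπ-inj {x} {y} jx≡jy = begin
    x          ≡⟨ Perm.inverseʳ π ⟨
    πʳ (πˡ x)  ≡⟨ ≡.cong πʳ (jπ-inj jππ) ⟩
    πʳ (πˡ y)  ≡⟨ Perm.inverseʳ π ⟩
    y          ∎
    where
    open ≡.≡-Reasoning
    jππ : j (πʳ (πˡ x)) ≡ j (πʳ (πˡ y))
    jππ = ≡.trans (≡.cong j (Perm.inverseʳ π)) (≡.trans jx≡jy (≡.cong j (≡.sym (Perm.inverseʳ π))))

injective-⇔-tail : ∀ {n N} (j : Fin (suc n) → Fin N) →
                   Injective _≡_ _≡_ j ⇔ (Injective _≡_ _≡_ (tail j) × ¬ ∃ λ i → tail j i ≡ head j)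
injective-⇔-tail j = mk⇔ to from
  where
  to : Injective _≡_ _≡_ j → Injective _≡_ _≡_ (tail j) × ¬ ∃ λ i → tail j i ≡ head j
  to j-inj = (λ ji≡jk → suc-injective (j-inj ji≡jk)) , λ { (i , ji≡j0) → 0≢1+n (≡.sym (j-inj ji≡j0)) }
  from : Injective _≡_ _≡_ (tail j) × ¬ ∃ (λ i → tail j i ≡ head j) → Injective _≡_ _≡_ j
  from (tail-inj , j0∉tail) {zero} {zero} _ = ≡.refl
  from (tail-inj , j0∉tail) {zero} {suc y} j0≡jy = ⊥-elim (j0∉tail (y , ≡.sym j0≡jy))
  from (tail-inj , j0∉tail) {suc x} {zero} jx≡j0 = ⊥-elim (j0∉tail (x , jx≡j0))
  from (tail-inj , j0∉tail) {suc x} {suc y} jx≡jy = ≡.cong suc (tail-inj jx≡jy)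

injective?-tail : ∀ {n N} (j : Fin (suc n) → Fin N) →
                  does (injective? j) ≡ does (injective? (tail j)) ∧ not (does (∈-image? (tail j) (head j)))
injective?-tail j = does-⇔ (injective-⇔-tail j)
  (injective? j) (injective? (tail j) ×-dec ¬? (∈-image? (tail j) (head j)))

module Summation {c ℓ} (A : QAlgebra c ℓ) where
  open QAlgebra A hiding (zero)
  open Ops A
  open IsRingHomomorphism ι-hom using (+-homo; *-homo; -‿homo; 0#-homo; 1#-homo)
  open import Relation.Binary.Reasoning.Setoid setoid
  import Algebra.Properties.Semiring.Sum semiring as Sum
  import Algebra.Properties.CommutativeMonoid.Sum *-commutativeMonoid as Product
  open import Algebra.Properties.Ring ring using (-1*x≈-x; -‿distribʳ-*)

  ι-morphism : ℚ.+-*-rawRing -Raw-AlmostCommutative⟶ fromCommutativeRing commRing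
  ι-morphism = record
    { ⟦_⟧ = ι ; +-homo = +-homo ; *-homo = *-homo ; -‿homo = -‿homo ; 0-homo = 0#-homo ; 1-homo = 1#-homo }

  ι-≟ : ∀ x y → Maybe (ι x ≈ ι y)
  ι-≟ x y with x ℚ.≟ y
  ... | yes ≡.refl = just refl
  ... | no _ = nothing

  open RingSolver ℚ.+-*-rawRing (fromCommutativeRing commRing) ι-morphism ι-≟
    using (solve; _:+_; _:*_; _:-_; :-_; _:=_; con) public

  ½ : Carrier
  ½ = ι (+ 1 / 2)

  half-double : ∀ x → x ≈ ½ * (x + x)
  half-double = solve 1 (λ x → x := con (+ 1 / 2) :* (x :+ x)) refl

  w*[u-v]≈-w*[v-u] : ∀ w u v → w * (u - v) ≈ - (w * (v - u))
  w*[u-v]≈-w*[v-u] = solve 3 (λ w u v → w :* (u :- v) := :- (w :* (v :- u))) refl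

  when : Bool → Carrier → Carrier
  when b x = if b then x else 0#

  when-cong : ∀ b {x y} → x ≈ y → when b x ≈ when b y
  when-cong true x≈y = x≈y
  when-cong false _ = refl

  when-+ : ∀ b x y → when b (x + y) ≈ when b x + when b y
  when-+ true x y = refl
  when-+ false x y = sym (+-identityˡ 0#)

  when-* : ∀ b a x → when b (a * x) ≈ a * when b x
  when-* true a x = refl
  when-* false a x = sym (zeroʳ a)

  when-∧ : ∀ b b′ x → when (b ∧ b′) x ≡ when b (when b′ x)
  when-∧ true b′ x = ≡.refl
  when-∧ false b′ x = ≡.refl

  ∑≡sum : ∀ {k} (f : Fin k → Carrier) → ∑ f ≡ Sum.sum f
  ∑≡sum {zero} f = ≡.refl
  ∑≡sum {suc k} f = ≡.cong (λ x → f zero + x) (∑≡sum (f ∘ suc))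

  ∏≡product : ∀ {k} (f : Fin k → Carrier) → ∏ f ≡ Product.sum f
  ∏≡product {zero} f = ≡.refl
  ∏≡product {suc k} f = ≡.cong (f zero *_) (∏≡product (f ∘ suc))

  ∑-cong : ∀ {k} {f g : Fin k → Carrier} → (∀ i → f i ≈ g i) → ∑ f ≈ ∑ g
  ∑-cong {f = f} {g} f≈g rewrite ∑≡sum f | ∑≡sum g = Sum.sum-cong-≋ f≈g

  ∑-zero : ∀ k → ∑ {k} (λ _ → 0#) ≈ 0#
  ∑-zero k rewrite ∑≡sum {k} (λ _ → 0#) = Sum.sum-replicate-zero k

  ∑-distrib-+ : ∀ {k} (f g : Fin k → Carrier) → ∑ (λ i → f i + g i) ≈ ∑ f + ∑ g
  ∑-distrib-+ f g rewrite ∑≡sum (λ i → f i + g i) | ∑≡sum f | ∑≡sum g = Sum.∑-distrib-+ f g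

  *-distribˡ-∑ : ∀ {k} a (f : Fin k → Carrier) → a * ∑ f ≈ ∑ (λ i → a * f i)
  *-distribˡ-∑ a f rewrite ∑≡sum f | ∑≡sum (λ i → a * f i) = Sum.*-distribˡ-sum a f

  ∑-comm : ∀ {k l} (f : Fin k → Fin l → Carrier) →
           ∑ (λ i → ∑ (f i)) ≈ ∑ (λ j → ∑ (λ i → f i j))
  ∑-comm f = begin
    ∑ (λ i → ∑ (f i))                   ≡⟨ double (λ i j → f i j) ⟩
    Sum.sum (λ i → Sum.sum (f i))         ≈⟨ Sum.∑-comm f ⟩
    Sum.sum (λ j → Sum.sum (λ i → f i j)) ≡⟨ double (λ j i → f i j) ⟨
    ∑ (λ j → ∑ (λ i → f i j))           ∎
    where
    double : ∀ {k l} (g : Fin k → Fin l → Carrier) → ∑ (λ i → ∑ (g i)) ≡ Sum.sum (λ i → Sum.sum (g i))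
    double g = ≡.trans (∑≡sum (λ i → ∑ (g i))) (Sum.sum-cong-≗ (λ i → ∑≡sum (g i)))

  ∑-neg : ∀ {k} (f : Fin k → Carrier) → ∑ (λ i → - f i) ≈ - ∑ f
  ∑-neg f = begin
    ∑ (λ i → - f i)        ≈⟨ ∑-cong (λ i → -1*x≈-x (f i)) ⟨
    ∑ (λ i → - 1# * f i)   ≈⟨ *-distribˡ-∑ (- 1#) f ⟨
    - 1# * ∑ f             ≈⟨ -1*x≈-x (∑ f) ⟩
    - ∑ f                  ∎

  ∑-δ : ∀ {k} (a : Fin k) (h : Fin k → Carrier) → ∑ (λ i → when (does (a ≟ᶠ i)) (h i)) ≈ h a
  ∑-δ {suc k} zero h = trans (+-congˡ (∑-zero k)) (+-identityʳ (h zero))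
  ∑-δ (suc a) h = trans (+-identityˡ _) (∑-δ a (h ∘ suc))

  when-∑ : ∀ {k} b (f : Fin k → Carrier) → when b (∑ f) ≈ ∑ (λ i → when b (f i))
  when-∑ true f = refl
  when-∑ {k} false f = sym (∑-zero k)

  ∏-cong : ∀ {k} {f g : Fin k → Carrier} → (∀ i → f i ≈ g i) → ∏ f ≈ ∏ g
  ∏-cong {f = f} {g} f≈g rewrite ∏≡product f | ∏≡product g = Product.sum-cong-≋ f≈g

  ∏-remove : ∀ {k} (f : Fin (suc k) → Carrier) i → ∏ f ≈ f i * ∏ (removeAt f i)
  ∏-remove f i rewrite ∏≡product f | ∏≡product (removeAt f i) = Product.sum-remove f

  ∏-pick : ∀ {k} (g h : Fin k → Carrier) t → (∀ l → l ≢ t → g l ≈ h l) → h t ≈ 1# →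
           ∏ g ≈ g t * ∏ h
  ∏-pick {suc k} g h t g≈h ht≈1 = begin
    ∏ g                             ≈⟨ ∏-remove g t ⟩
    g t * ∏ (removeAt g t)          ≈⟨ *-congˡ (∏-cong (λ i → g≈h (punchIn t i) (punchInᵢ≢i t i))) ⟩
    g t * ∏ (removeAt h t)          ≈⟨ *-congˡ (*-identityˡ _) ⟨
    g t * (1# * ∏ (removeAt h t))   ≈⟨ *-congˡ (*-congʳ ht≈1) ⟨
    g t * (h t * ∏ (removeAt h t))  ≈⟨ *-congˡ (∏-remove h t) ⟨
    g t * ∏ h                       ∎

  ∑-const : ∀ k x → ∑ {k} (λ _ → x) ≈ ι (natℚ k) * x
  ∑-const zero x = sym (trans (*-congʳ 0#-homo) (zeroˡ x))
  ∑-const (suc k) x = begin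
    x + ∑ {k} (λ _ → x)          ≈⟨ +-cong (sym (*-identityˡ x)) (∑-const k x) ⟩
    1# * x + ι (natℚ k) * x      ≈⟨ distribʳ x 1# (ι (natℚ k)) ⟨
    (1# + ι (natℚ k)) * x        ≈⟨ *-congʳ (+-congʳ 1#-homo) ⟨
    (ι ℚ.1ℚ + ι (natℚ k)) * x    ≈⟨ *-congʳ (+-homo ℚ.1ℚ (natℚ k)) ⟨
    ι (ℚ.1ℚ ℚ.+ natℚ k) * x      ≡⟨ ≡.cong (λ q → ι q * x) (natℚ-suc k) ⟨
    ι (natℚ (suc k)) * x         ∎

  mean-const : ∀ {N} .{{_ : ℕ.NonZero N}} x → ι (recip N) * ∑ {N} (λ _ → x) ≈ x
  mean-const {suc m} x = begin
    ι (recip (suc m)) * ∑ {suc m} (λ _ → x)          ≈⟨ *-congˡ (∑-const (suc m) x) ⟩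
    ι (recip (suc m)) * (ι (natℚ (suc m)) * x)      ≈⟨ *-assoc _ _ _ ⟨
    ι (recip (suc m)) * ι (natℚ (suc m)) * x        ≈⟨ *-congʳ (*-homo (recip (suc m)) (natℚ (suc m))) ⟨
    ι (recip (suc m) ℚ.* natℚ (suc m)) * x          ≡⟨ ≡.cong (λ q → ι q * x) (recip-inverseˡ m) ⟩
    ι ℚ.1ℚ * x                                      ≈⟨ *-congʳ 1#-homo ⟩
    1# * x                                          ≈⟨ *-identityˡ x ⟩
    x                                               ∎

  mean-deviation : ∀ {N} .{{_ : ℕ.NonZero N}} a (f : Fin N → Carrier) →
                   ι (recip N) * ∑ (λ k → a - f k) ≈ a - ι (recip N) * ∑ f
  mean-deviation {N} a f = begin
    I * ∑ (λ k → a - f k)                 ≈⟨ *-congˡ (∑-distrib-+ (λ _ → a) (λ k → - f k)) ⟩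
    I * (∑ {N} (λ _ → a) + ∑ (λ k → - f k)) ≈⟨ *-congˡ (+-congˡ (∑-neg f)) ⟩
    I * (∑ {N} (λ _ → a) + - ∑ f)          ≈⟨ distribˡ I _ _ ⟩
    I * ∑ {N} (λ _ → a) + I * - ∑ f        ≈⟨ +-cong (mean-const a) (sym (-‿distribʳ-* I (∑ f))) ⟩
    a - I * ∑ f                            ∎
    where
    I = ι (recip N)

  module _ {N n : ℕ} (z : Fin N → Fin n → Carrier) where
    factor : (Fin n → Fin N) → Subset n → Fin n → Carrier
    factor j S l = if does (l ∈? S) then z (j l) l else 1#

    factor-∈ : ∀ j {S l} → l ∈ S → factor j S l ≡ z (j l) l
    factor-∈ j {S} {l} l∈S = ≡.cong (if_then z (j l) l else 1#) (dec-true (l ∈? S) l∈S)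

    factor-∉ : ∀ j {S l} → l ∉ S → factor j S l ≡ 1#
    factor-∉ j {S} {l} l∉S = ≡.cong (if_then z (j l) l else 1#) (dec-false (l ∈? S) l∉S)

    p-split : ∀ j {S S′ : Subset n} {t} → t ∈ S → t ∉ S′ → (∀ l → l ≢ t → l ∈ S ⇔ l ∈ S′) →
              p z j S ≈ z (j t) t * p z j S′
    p-split j {S} {S′} {t} t∈S t∉S′ S⇔S′ =
      trans (∏-pick (factor j S) (factor j S′) t agree (reflexive (factor-∉ j t∉S′)))
            (*-congʳ (reflexive (factor-∈ j t∈S)))
      where
      agree : ∀ l → l ≢ t → factor j S l ≈ factor j S′ l
      agree l l≢t =
        reflexive (≡.cong (if_then z (j l) l else 1#) (does-⇔ (S⇔S′ l l≢t) (l ∈? S) (l ∈? S′)))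

    p-agree : ∀ (S : Subset n) {g h} → (∀ l → l ∈ S → g l ≡ h l) → p z g S ≈ p z h S
    p-agree S {g} {h} g≡h = ∏-cong (λ l → agree l (l ∈? S))
      where
      agree : ∀ l (d : Dec (l ∈ S)) → (if does d then z (g l) l else 1#) ≈ (if does d then z (h l) l else 1#)
      agree l (yes l∈S) = reflexive (≡.cong (λ a → z a l) (g≡h l l∈S))
      agree l (no _) = refl

    p-∪-⁅⁆ : ∀ j {R t} → t ∉ R → p z j (R ∪ ⁅ t ⁆) ≈ z (j t) t * p z j R
    p-∪-⁅⁆ j {R} {t} t∉R = p-split j (x∈p∪q⁺ (inj₂ (x∈⁅x⁆ t))) t∉R (λ l l≢t → mk⇔
      (λ l∈R∪t → [ (λ l∈R → l∈R) , (λ l∈t → ⊥-elim (l≢t (x∈⁅y⁆⇒x≡y t l∈t))) ]′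
                 (x∈p∪q⁻ R ⁅ t ⁆ l∈R∪t))
      (λ l∈R → x∈p∪q⁺ (inj₁ l∈R)))

    p-remove : ∀ j {R q} → q ∈ R → p z j R ≈ z (j q) q * p z j (R -ₛ q)
    p-remove j {R} {q} q∈R = p-split j q∈R (λ q∈R-q → x∈p-y⇒x≢y R q∈R-q ≡.refl)
      (λ l l≢q → mk⇔ (λ l∈R → x∈p∧x≢y⇒x∈p-y l∈R l≢q) (p─q⊆p R ⁅ q ⁆))

  module _ {N : ℕ} where
    Extensional : ∀ {n} → ((Fin n → Fin N) → Carrier) → Set _
    Extensional F = ∀ {g h} → g ≗ h → F g ≈ F h

    ∑map-cong : ∀ n {F G : (Fin n → Fin N) → Carrier} → (∀ j → F j ≈ G j) → ∑map n F ≈ ∑map n G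
    ∑map-cong zero F≈G = F≈G _
    ∑map-cong (suc n) F≈G = ∑-cong {N} (λ a → ∑map-cong n (λ g → F≈G _))

    ∑map-distrib-+ : ∀ n (F G : (Fin n → Fin N) → Carrier) →
                     ∑map n (λ j → F j + G j) ≈ ∑map n F + ∑map n G
    ∑map-distrib-+ zero F G = refl
    ∑map-distrib-+ (suc n) F G = trans (∑-cong {N} (λ a → ∑map-distrib-+ n _ _)) (∑-distrib-+ {N} _ _)

    *-distribˡ-∑map : ∀ n a (F : (Fin n → Fin N) → Carrier) → a * ∑map n F ≈ ∑map n (λ j → a * F j)
    *-distribˡ-∑map zero a F = refl
    *-distribˡ-∑map (suc n) a F = trans (*-distribˡ-∑ {N} a _) (∑-cong {N} (λ b → *-distribˡ-∑map n a _))

    ∑-∑map-comm : ∀ {k} n (F : Fin k → (Fin n → Fin N) → Carrier) →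
                  ∑ (λ a → ∑map n (F a)) ≈ ∑map n (λ j → ∑ (λ a → F a j))
    ∑-∑map-comm zero F = refl
    ∑-∑map-comm {k} (suc n) F = trans (∑-comm {k} {N} _) (∑-cong {N} (λ b → ∑-∑map-comm {k} n _))

    ∑map-∷ : ∀ n (F : (Fin (suc n) → Fin N) → Carrier) → Extensional F →
             ∑map (suc n) F ≈ ∑ (λ a → ∑map n (λ g → F (a ∷ g)))
    ∑map-∷ n F ext =
      ∑-cong {N} (λ a → ∑map-cong n (λ g → ext (λ { zero → ≡.refl ; (suc i) → ≡.refl })))

    ∑map-insertAt : ∀ n (k : Fin (suc n)) (F : (Fin (suc n) → Fin N) → Carrier) → Extensional F →
                    ∑map (suc n) F ≈ ∑ (λ a → ∑map n (λ g → F (insertAt g k a)))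
    ∑map-insertAt n zero F ext =
      ∑-cong {N} (λ a → ∑map-cong n (λ g → ext (λ { zero → ≡.refl ; (suc i) → ≡.refl })))
    ∑map-insertAt (suc n) (suc k) F ext = begin
      ∑map (suc (suc n)) F
        ≈⟨ ∑map-∷ (suc n) F ext ⟩
      ∑ (λ b → ∑map (suc n) (λ g → F (b ∷ g)))
        ≈⟨ ∑-cong (λ b → ∑map-insertAt n k (λ g → F (b ∷ g)) (λ g≗h → ext (∷-cong b g≗h))) ⟩
      ∑ (λ b → ∑ (λ a → ∑map n (λ h → F (b ∷ insertAt h k a))))
        ≈⟨ ∑-comm {N} {N} _ ⟩
      ∑ (λ a → ∑ (λ b → ∑map n (λ h → F (b ∷ insertAt h k a))))
        ≈⟨ ∑-cong {N} (λ a → ∑-cong {N} (λ b →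
             ∑map-cong n (λ h → ext (λ { zero → ≡.refl ; (suc i) → ≡.refl })))) ⟩
      ∑ (λ a → ∑ (λ b → ∑map n (λ h → F (insertAt (b ∷ h) (suc k) a))))
        ≈⟨ ∑-cong (λ a → ∑map-∷ n _ (λ g≗h → ext (insertAt-cong (suc k) a g≗h))) ⟨
      ∑ (λ a → ∑map (suc n) (λ g → F (insertAt g (suc k) a)))
        ∎
      where
      ∷-cong : ∀ {m} b {g h : Fin m → Fin N} → g ≗ h → b ∷ g ≗ b ∷ h
      ∷-cong b g≗h zero = ≡.refl
      ∷-cong b g≗h (suc i) = g≗h i

    ∑map-permute : ∀ n (π : Permutation n n) (F : (Fin n → Fin N) → Carrier) → Extensional F →
                   ∑map n F ≈ ∑map n (λ j → F (j ∘ (π ⟨$⟩ʳ_)))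
    ∑map-permute zero π F ext = ext (λ ())
    ∑map-permute (suc n) π F ext = begin
      ∑map (suc n) F
        ≈⟨ ∑map-∷ n F ext ⟩
      ∑ (λ a → ∑map n (λ g → F (a ∷ g)))
        ≈⟨ ∑-cong (λ a → ∑map-permute n π₀ (λ g → F (a ∷ g))
                                         (λ g≗h → ext (λ { zero → ≡.refl ; (suc i) → g≗h i }))) ⟩
      ∑ (λ a → ∑map n (λ g → F (a ∷ (g ∘ (π₀ ⟨$⟩ʳ_)))))
        ≈⟨ ∑-cong (λ a → ∑map-cong n (λ g → ext (insertAt-∘-π a g))) ⟩
      ∑ (λ a → ∑map n (λ g → F (insertAt g k a ∘ (π ⟨$⟩ʳ_))))
        ≈⟨ ∑map-insertAt n k (λ j → F (j ∘ (π ⟨$⟩ʳ_))) (λ g≗h → ext (g≗h ∘ (π ⟨$⟩ʳ_))) ⟨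
      ∑map (suc n) (λ j → F (j ∘ (π ⟨$⟩ʳ_)))
        ∎
      where
      π₀ = Perm.remove zero π
      k = π ⟨$⟩ʳ zero
      insertAt-∘-π : ∀ a g → a ∷ (g ∘ (π₀ ⟨$⟩ʳ_)) ≗ insertAt g k a ∘ (π ⟨$⟩ʳ_)
      insertAt-∘-π a g zero = ≡.sym (insertAt-lookup g k a)
      insertAt-∘-π a g (suc i) = ≡.sym (≡.trans (≡.cong (insertAt g k a) (Perm.punchIn-permute π zero i))
                                                 (insertAt-punchIn g k a _))

    ∑inj-cong : ∀ n {F G : (Fin n → Fin N) → Carrier} → (∀ j → Injective _≡_ _≡_ j → F j ≈ G j) →
                ∑inj n F ≈ ∑inj n G
    ∑inj-cong n {F} {G} F≈G = ∑map-cong n (λ j → on (injective? j))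
      where
      on : ∀ {j} (d : Dec (Injective _≡_ _≡_ j)) → when (does d) (F j) ≈ when (does d) (G j)
      on (yes j-inj) = F≈G _ j-inj
      on (no _) = refl

    ∑inj-cong′ : ∀ n {F G : (Fin n → Fin N) → Carrier} → (∀ j → F j ≈ G j) → ∑inj n F ≈ ∑inj n G
    ∑inj-cong′ n F≈G = ∑inj-cong n (λ j _ → F≈G j)

    ∑inj-distrib-+ : ∀ n (F G : (Fin n → Fin N) → Carrier) →
                     ∑inj n (λ j → F j + G j) ≈ ∑inj n F + ∑inj n G
    ∑inj-distrib-+ n F G = trans (∑map-cong n (λ j → when-+ _ _ _)) (∑map-distrib-+ n _ _)

    *-distribˡ-∑inj : ∀ n a (F : (Fin n → Fin N) → Carrier) → a * ∑inj n F ≈ ∑inj n (λ j → a * F j)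
    *-distribˡ-∑inj n a F = trans (*-distribˡ-∑map n a _) (∑map-cong n (λ j → sym (when-* _ _ _)))

    ∑inj-zero : ∀ n → ∑inj n (λ (j : Fin n → Fin N) → 0#) ≈ 0#
    ∑inj-zero n = begin
      ∑inj n (λ _ → 0#)          ≈⟨ ∑inj-cong′ n (λ _ → zeroˡ 0#) ⟨
      ∑inj n (λ _ → 0# * 0#)     ≈⟨ *-distribˡ-∑inj n 0# (λ _ → 0#) ⟨
      0# * ∑inj n (λ _ → 0#)     ≈⟨ zeroˡ _ ⟩
      0#                         ∎

    ∑inj-neg : ∀ n (F : (Fin n → Fin N) → Carrier) → ∑inj n (λ j → - F j) ≈ - ∑inj n F
    ∑inj-neg n F = begin
      ∑inj n (λ j → - F j)       ≈⟨ ∑inj-cong′ n (λ j → -1*x≈-x (F j)) ⟨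
      ∑inj n (λ j → - 1# * F j)  ≈⟨ *-distribˡ-∑inj n (- 1#) F ⟨
      - 1# * ∑inj n F            ≈⟨ -1*x≈-x _ ⟩
      - ∑inj n F                 ∎

    ∑inj-∑-comm : ∀ {k} n (F : (Fin n → Fin N) → Fin k → Carrier) →
                  ∑inj n (λ j → ∑ (F j)) ≈ ∑ (λ l → ∑inj n (λ j → F j l))
    ∑inj-∑-comm {k} n F =
      trans (∑map-cong n (λ j → when-∑ (does (injective? j)) (F j))) (sym (∑-∑map-comm {k} n _))

    when-injective-ext : ∀ {n} {F : (Fin n → Fin N) → Carrier} → Extensional F →
                         Extensional (λ j → when (does (injective? j)) (F j))
    when-injective-ext {F = F} ext {g} {h} g≗h = begin
      when (does (injective? g)) (F g)  ≡⟨ ≡.cong (λ b → when b (F g)) (injective?-≗ g≗h) ⟩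
      when (does (injective? h)) (F g)  ≈⟨ when-cong _ (ext g≗h) ⟩
      when (does (injective? h)) (F h)  ∎

    ∑inj-permute : ∀ n (π : Permutation n n) (F : (Fin n → Fin N) → Carrier) → Extensional F →
                   ∑inj n F ≈ ∑inj n (λ j → F (j ∘ (π ⟨$⟩ʳ_)))
    ∑inj-permute n π F ext = trans (∑map-permute n π _ (when-injective-ext ext))
      (∑map-cong n (λ j → reflexive
        (≡.cong (λ b → when b (F (j ∘ (π ⟨$⟩ʳ_)))) (injective?-∘-permutation j π))))

    ∑inj-symmetrize : ∀ n (π : Permutation n n) (F : (Fin n → Fin N) → Carrier) → Extensional F →
                      ∑inj n F ≈ ½ * ∑inj n (λ j → F j + F (j ∘ (π ⟨$⟩ʳ_)))
    ∑inj-symmetrize n π F ext = begin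
      ∑inj n F                                        ≈⟨ half-double _ ⟩
      ½ * (∑inj n F + ∑inj n F)                       ≈⟨ *-congˡ (+-congˡ (∑inj-permute n π F ext)) ⟩
      ½ * (∑inj n F + ∑inj n (λ j → F (j ∘ (π ⟨$⟩ʳ_)))) ≈⟨ *-congˡ (∑inj-distrib-+ n _ _) ⟨
      ½ * ∑inj n (λ j → F j + F (j ∘ (π ⟨$⟩ʳ_)))       ∎

    ∑inj-antisymmetric : ∀ n (π : Permutation n n) (F : (Fin n → Fin N) → Carrier) → Extensional F →
                         (∀ j → F (j ∘ (π ⟨$⟩ʳ_)) ≈ - F j) → ∑inj n F ≈ 0#
    ∑inj-antisymmetric n π F ext anti = begin
      ∑inj n F                                   ≈⟨ ∑inj-symmetrize n π F ext ⟩
      ½ * ∑inj n (λ j → F j + F (j ∘ (π ⟨$⟩ʳ_)))  ≈⟨ *-congˡ (∑inj-cong′ n cancel) ⟩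
      ½ * ∑inj n (λ _ → 0#)                      ≈⟨ *-congˡ (∑inj-zero n) ⟩
      ½ * 0#                                     ≈⟨ zeroʳ ½ ⟩
      0#                                         ∎
      where
      cancel : ∀ j → F j + F (j ∘ (π ⟨$⟩ʳ_)) ≈ 0#
      cancel j = trans (+-congˡ (anti j)) (-‿inverseʳ (F j))

    ∑-fibre : ∀ {n} {j : Fin n → Fin N} → Injective _≡_ _≡_ j → ∀ k x →
              ∑ (λ l → when (does (j l ≟ᶠ k)) x) + when (not (does (∈-image? j k))) x ≈ x
    ∑-fibre {n} {j} j-inj k x with ∈-image? j k
    ... | yes (l₀ , ≡.refl) = begin
      ∑ (λ l → when (does (j l ≟ᶠ j l₀)) x) + 0#  ≈⟨ +-identityʳ _ ⟩
      ∑ (λ l → when (does (j l ≟ᶠ j l₀)) x)       ≈⟨ ∑-cong (λ l → reflexive (≡.cong (λ b → when b x) (jl≟jl₀ l))) ⟩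
      ∑ (λ l → when (does (l₀ ≟ᶠ l)) x)           ≈⟨ ∑-δ l₀ (λ _ → x) ⟩
      x                                          ∎
      where
      jl≟jl₀ : ∀ l → does (j l ≟ᶠ j l₀) ≡ does (l₀ ≟ᶠ l)
      jl≟jl₀ l = does-⇔ (mk⇔ (≡.sym ∘ j-inj) (≡.cong j ∘ ≡.sym)) (j l ≟ᶠ j l₀) (l₀ ≟ᶠ l)
    ... | no k∉image = begin
      ∑ (λ l → when (does (j l ≟ᶠ k)) x) + x  ≈⟨ +-congʳ (∑-cong (λ l → reflexive (≡.cong (λ b → when b x) (jl≢k l)))) ⟩
      ∑ {n} (λ _ → 0#) + x                    ≈⟨ +-congʳ (∑-zero n) ⟩
      0# + x                                  ≈⟨ +-identityˡ x ⟩
      x                                       ∎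
      where
      jl≢k : ∀ l → does (j l ≟ᶠ k) ≡ false
      jl≢k l = dec-false (j l ≟ᶠ k) (λ jl≡k → k∉image (l , jl≡k))

    ∑-split-image : ∀ {n} {j : Fin n → Fin N} → Injective _≡_ _≡_ j → (h : Fin N → Carrier) →
                    ∑ h ≈ ∑ (h ∘ j) + ∑ (λ k → when (not (does (∈-image? j k))) (h k))
    ∑-split-image {n} {j} j-inj h = begin
      ∑ h
        ≈⟨ ∑-cong (λ k → ∑-fibre j-inj k (h k)) ⟨
      ∑ (λ k → ∑ (λ l → when (does (j l ≟ᶠ k)) (h k)) + outside k)
        ≈⟨ ∑-distrib-+ {N} _ _ ⟩
      ∑ (λ k → ∑ (λ l → when (does (j l ≟ᶠ k)) (h k))) + ∑ outside
        ≈⟨ +-congʳ (∑-comm {N} {n} _) ⟩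
      ∑ (λ l → ∑ (λ k → when (does (j l ≟ᶠ k)) (h k))) + ∑ outside
        ≈⟨ +-congʳ (∑-cong (λ l → ∑-δ (j l) h)) ⟩
      ∑ (h ∘ j) + ∑ outside
        ∎
      where
      outside : Fin N → Carrier
      outside k = when (not (does (∈-image? j k))) (h k)

    ∑inj-∑-outside-image : ∀ n (F : (Fin n → Fin N) → Fin N → Carrier) →
      (∀ k → Extensional (λ j → F j k)) →
      ∑inj n (λ j → ∑ (λ k → when (not (does (∈-image? j k))) (F j k)))
        ≈ ∑inj (suc n) (λ j → F (tail j) (head j))
    ∑inj-∑-outside-image n F ext = begin
      ∑inj n (λ j → ∑ (λ k → when (not (does (∈-image? j k))) (F j k)))
        ≈⟨ ∑inj-∑-comm {N} n _ ⟩
      ∑ (λ k → ∑map n (λ g → when (does (injective? g)) (when (not (does (∈-image? g k))) (F g k))))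
        ≈⟨ ∑-cong {N} (λ k → ∑map-cong n (λ g → reflexive (≡.sym (injective-∷ k g)))) ⟩
      ∑ (λ k → ∑map n (λ g → when (does (injective? (k ∷ g))) (F g k)))
        ≈⟨ ∑map-∷ n _ (when-injective-ext ext′) ⟨
      ∑inj (suc n) (λ j → F (tail j) (head j))
        ∎
      where
      injective-∷ : ∀ k g → when (does (injective? (k ∷ g))) (F g k)
                            ≡ when (does (injective? g)) (when (not (does (∈-image? g k))) (F g k))
      injective-∷ k g = ≡.trans (≡.cong (λ b → when b (F g k)) (injective?-tail (k ∷ g)))
                                (when-∧ (does (injective? g)) (not (does (∈-image? g k))) (F g k))
      ext′ : Extensional (λ j → F (tail j) (head j))
      ext′ {g} {h} g≗h = trans (ext (head g) (g≗h ∘ suc)) (reflexive (≡.cong (F (tail h)) (g≗h zero)))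

module Identity {c ℓ} (A : QAlgebra c ℓ) {N n : ℕ} .{{_ : ℕ.NonZero N}}
  (z : Fin N → Fin n → QAlgebra.Carrier A) (R : Subset n) {r s t : Fin n}
  (r∉R : r ∉ R) (s∉R : s ∉ R) (t∉R : t ∉ R) (r≢s : r ≢ s) (r≢t : r ≢ t) (s≢t : s ≢ t) where
  open QAlgebra A hiding (zero)
  open Ops A
  open Summation A
  open import Algebra.Properties.Ring ring using (-‿distribʳ-*; -0#≈0#)
  open import Algebra.Properties.CommutativeSemigroup *-commutativeSemigroup using (x∙yz≈y∙xz; xy∙z≈xz∙y)
  open import Relation.Binary.Reasoning.Setoid setoid

  Y : (Fin n → Fin N) → Carrier
  Y j = y z (j r) (j s) r * y z (j r) (j s) s

  G : (Fin n → Fin N) → Fin N → Carrier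
  G j k = Y j * p z j R * y z (j t) k t

  H : Fin n → Carrier
  H l = ∑inj n (λ j → G j (j l))

  K : Fin n → Carrier
  K q = ∑inj n (λ j → Y j * y z (j t) (j q) t * y z (j t) (j q) q * p z j (R -ₛ q))

  y-cong : ∀ {a b a′ b′} l → a ≡ a′ → b ≡ b′ → y z a b l ≈ y z a′ b′ l
  y-cong l ≡.refl ≡.refl = refl

  Y-agree : ∀ {g h : Fin n → Fin N} → g r ≡ h r → g s ≡ h s → Y g ≈ Y h
  Y-agree gr≡hr gs≡hs = *-cong (y-cong r gr≡hr gs≡hs) (y-cong s gr≡hr gs≡hs)

  G-ext : ∀ {g h : Fin n → Fin N} {k k′} → g ≗ h → k ≡ k′ → G g k ≈ G h k′
  G-ext g≗h k≡k′ =
    *-cong (*-cong (Y-agree (g≗h r) (g≗h s)) (p-agree z R (λ l _ → g≗h l))) (y-cong t (g≗h t) k≡k′)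

  summand≈mean : ∀ j → Y j * (p z j (R ∪ ⁅ t ⁆) - z~ z t * p z j R) ≈ ι (recip N) * ∑ (G j)
  summand≈mean j = sym (begin
    I * ∑ (λ k → W * y z (j t) k t)               ≈⟨ *-congˡ (*-distribˡ-∑ {N} W _) ⟨
    I * (W * ∑ (λ k → z (j t) t - z k t))         ≈⟨ x∙yz≈y∙xz I W _ ⟩
    W * (I * ∑ (λ k → z (j t) t - z k t))         ≈⟨ *-congˡ (mean-deviation (z (j t) t) (λ k → z k t)) ⟩
    W * (z (j t) t - z~ z t)                      ≈⟨ solve 4 (λ a b u v → a :* b :* (u :- v) := a :* (u :* b :- v :* b))
                                                           refl (Y j) (p z j R) (z (j t) t) (z~ z t) ⟩
    Y j * (z (j t) t * p z j R - z~ z t * p z j R) ≈⟨ *-congˡ (+-congʳ (p-∪-⁅⁆ z j t∉R)) ⟨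
    Y j * (p z j (R ∪ ⁅ t ⁆) - z~ z t * p z j R)  ∎)
    where
    I = ι (recip N)
    W = Y j * p z j R

  ∑G-outside-image : ∑inj n (λ j → ∑ (λ k → when (not (does (∈-image? j k))) (G j k))) ≈ 0#
  ∑G-outside-image = trans (∑inj-∑-outside-image n G (λ k g≗h → G-ext g≗h ≡.refl))
    (∑inj-antisymmetric (suc n) (Perm.transpose zero (suc t)) Ĝ (λ g≗h → G-ext (g≗h ∘ suc) (g≗h zero)) anti)
    where
    Ĝ : (Fin (suc n) → Fin N) → Carrier
    Ĝ j = G (tail j) (head j)
    τ = PC.transpose {suc n} zero (suc t)
    τ-fixes : ∀ {l} → l ≢ t → τ (suc l) ≡ suc l
    τ-fixes l≢t = transpose-other {a = zero} {b = suc t} (λ ()) (l≢t ∘ suc-injective)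
    anti : ∀ j → Ĝ (j ∘ τ) ≈ - Ĝ j
    anti j = trans (*-cong
      (*-cong (Y-agree {g = tail (j ∘ τ)} {h = tail j} (≡.cong j (τ-fixes r≢t)) (≡.cong j (τ-fixes s≢t)))
              (p-agree z R (λ l l∈R → ≡.cong j (τ-fixes (λ l≡t → t∉R (≡.subst (_∈ R) l≡t l∈R))))))
      (y-cong t (≡.cong j (transpose-matchʳ zero (suc t))) (≡.cong j (transpose-matchˡ zero (suc t)))))
      (w*[u-v]≈-w*[v-u] _ _ _)

  ∑G≈∑H : ∑inj n (λ j → ∑ (G j)) ≈ ∑ H
  ∑G≈∑H = begin
    ∑inj n (λ j → ∑ (G j))
      ≈⟨ ∑inj-cong n (λ j j-inj → ∑-split-image j-inj (G j)) ⟩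
    ∑inj n (λ j → ∑ (λ l → G j (j l)) + ∑ (λ k → when (not (does (∈-image? j k))) (G j k)))
      ≈⟨ ∑inj-distrib-+ n _ _ ⟩
    ∑inj n (λ j → ∑ (λ l → G j (j l))) + ∑inj n (λ j → ∑ (λ k → when (not (does (∈-image? j k))) (G j k)))
      ≈⟨ +-cong (∑inj-∑-comm {k = n} n _) ∑G-outside-image ⟩
    ∑ H + 0#
      ≈⟨ +-identityʳ _ ⟩
    ∑ H ∎

  H-r : H r ≈ ∑inj n (λ j → Y j * y z (j t) (j r) t * p z j R)
  H-r = ∑inj-cong′ n (λ j → xy∙z≈xz∙y (Y j) (p z j R) _)

  H-s : H s ≈ H r
  H-s = trans (∑inj-permute n (Perm.transpose r s) _ (λ g≗h → G-ext g≗h (g≗h s))) (∑inj-cong′ n swap)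
    where
    τ = PC.transpose r s
    swap : ∀ j → G (j ∘ τ) (j (τ s)) ≈ G j (j r)
    swap j = *-cong (*-cong
      (trans (*-cong (y-cong r (≡.cong j (transpose-matchˡ r s)) (≡.cong j (transpose-matchʳ r s)))
                     (y-cong s (≡.cong j (transpose-matchˡ r s)) (≡.cong j (transpose-matchʳ r s))))
             (solve 4 (λ a b c d → (b :- a) :* (d :- c) := (a :- b) :* (c :- d)) refl _ _ _ _))
      (p-agree z R (λ l l∈R → ≡.cong j (transpose-∉ r∉R s∉R l∈R))))
      (y-cong t (≡.cong j (transpose-other (r≢t ∘ ≡.sym) (s≢t ∘ ≡.sym))) (≡.cong j (transpose-matchʳ r s)))

  H-t : H t ≈ 0#
  H-t = trans (∑inj-cong′ n (λ j → trans (*-congˡ (-‿inverseʳ _)) (zeroʳ _))) (∑inj-zero n)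

  H-outside : ∀ {l} → l ∉ R → l ≢ r → l ≢ s → l ≢ t → H l ≈ 0#
  H-outside {l} l∉R l≢r l≢s l≢t =
    ∑inj-antisymmetric n (Perm.transpose t l) _ (λ g≗h → G-ext g≗h (g≗h l)) anti
    where
    τ = PC.transpose t l
    τr≡r = transpose-other r≢t (l≢r ∘ ≡.sym)
    τs≡s = transpose-other s≢t (l≢s ∘ ≡.sym)
    anti : ∀ j → G (j ∘ τ) (j (τ l)) ≈ - G j (j l)
    anti j = trans (*-cong
      (*-cong (Y-agree (≡.cong j τr≡r) (≡.cong j τs≡s))
              (p-agree z R (λ m m∈R → ≡.cong j (transpose-∉ t∉R l∉R m∈R))))
      (y-cong t (≡.cong j (transpose-matchˡ t l)) (≡.cong j (transpose-matchʳ t l))))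
      (w*[u-v]≈-w*[v-u] _ _ _)

  H-inside : ∀ {q} → q ∈ R → H q ≈ - (½ * K q)
  H-inside {q} q∈R = begin
    H q                                           ≈⟨ ∑inj-cong′ n Gq≈Aq ⟩
    ∑inj n Aq                                     ≈⟨ ∑inj-symmetrize n (Perm.transpose t q) Aq Aq-ext ⟩
    ½ * ∑inj n (λ j → Aq j + Aq (j ∘ τ))          ≈⟨ *-congˡ (∑inj-cong′ n symmetrized) ⟩
    ½ * ∑inj n (λ j → - Kq j)                     ≈⟨ *-congˡ (∑inj-neg n Kq) ⟩
    ½ * - K q                                     ≈⟨ -‿distribʳ-* ½ (K q) ⟨
    - (½ * K q)                                   ∎
    where
    τ = PC.transpose t q
    S = R -ₛ q
    q∉ : ∀ {u} → u ∉ R → q ≢ u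
    q∉ u∉R q≡u = u∉R (≡.subst (_∈ R) q≡u q∈R)
    τr≡r = transpose-other r≢t (q∉ r∉R ∘ ≡.sym)
    τs≡s = transpose-other s≢t (q∉ s∉R ∘ ≡.sym)
    t∉S : t ∉ S
    t∉S t∈S = t∉R (p─q⊆p R ⁅ q ⁆ t∈S)
    q∉S : q ∉ S
    q∉S q∈S = x∈p-y⇒x≢y R q∈S ≡.refl
    Aq : (Fin n → Fin N) → Carrier
    Aq j = Y j * p z j S * y z (j t) (j q) t * z (j q) q
    Kq : (Fin n → Fin N) → Carrier
    Kq j = Y j * y z (j t) (j q) t * y z (j t) (j q) q * p z j S
    Aq-ext : Extensional Aq
    Aq-ext g≗h = *-cong (*-cong (*-cong (Y-agree (g≗h r) (g≗h s)) (p-agree z S (λ l _ → g≗h l)))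
                                 (y-cong t (g≗h t) (g≗h q)))
                         (reflexive (≡.cong (λ a → z a q) (g≗h q)))
    Gq≈Aq : ∀ j → G j (j q) ≈ Aq j
    Gq≈Aq j = trans (*-congʳ (*-congˡ (p-remove z j q∈R)))
      (solve 4 (λ a w b v → a :* (w :* b) :* v := a :* b :* v :* w) refl (Y j) (z (j q) q) (p z j S) _)
    symmetrized : ∀ j → Aq j + Aq (j ∘ τ) ≈ - Kq j
    symmetrized j = trans (+-congˡ (*-cong (*-cong (*-cong
        (Y-agree (≡.cong j τr≡r) (≡.cong j τs≡s))
        (p-agree z S (λ m m∈S → ≡.cong j (transpose-∉ t∉S q∉S m∈S))))
        (y-cong t (≡.cong j (transpose-matchˡ t q)) (≡.cong j (transpose-matchʳ t q))))
        (reflexive (≡.cong (λ a → z a q) (≡.cong j (transpose-matchʳ t q))))))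
      (solve 6 (λ a b u v w x → a :* b :* (u :- v) :* w :+ a :* b :* (v :- u) :* x
                               := :- (a :* (u :- v) :* (x :- w) :* b))
             refl (Y j) (p z j S) (z (j t) t) (z (j q) t) (z (j q) q) (z (j t) q))

  H-cases : ∀ l → H l ≈ when (does (r ≟ᶠ l)) (H r) + when (does (s ≟ᶠ l)) (H r)
                        + - (½ * when (does (l ∈? R)) (K l))
  H-cases l = cases (r ≟ᶠ l) (s ≟ᶠ l) (l ∈? R) (t ≟ᶠ l)
    where
    drop-K : ∀ x → x + - (½ * 0#) ≈ x
    drop-K x = trans (+-congˡ (trans (-‿cong (zeroʳ ½)) -0#≈0#)) (+-identityʳ x)
    cases : (d₁ : Dec (r ≡ l)) (d₂ : Dec (s ≡ l)) (d₃ : Dec (l ∈ R)) → Dec (t ≡ l) →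
            H l ≈ when (does d₁) (H r) + when (does d₂) (H r) + - (½ * when (does d₃) (K l))
    cases (yes ≡.refl) (yes s≡r) _ _ = ⊥-elim (r≢s (≡.sym s≡r))
    cases (yes ≡.refl) (no _) (yes r∈R) _ = ⊥-elim (r∉R r∈R)
    cases (yes ≡.refl) (no _) (no _) _ = sym (trans (drop-K _) (+-identityʳ _))
    cases (no _) (yes ≡.refl) (yes s∈R) _ = ⊥-elim (s∉R s∈R)
    cases (no _) (yes ≡.refl) (no _) _ = sym (trans (drop-K _) (trans (+-identityˡ _) (sym H-s)))
    cases (no _) (no _) (yes l∈R) _ =
      trans (H-inside l∈R) (sym (trans (+-congʳ (+-identityˡ 0#)) (+-identityˡ _)))
    cases (no _) (no _) (no _) (yes ≡.refl) = trans H-t (sym (trans (drop-K _) (+-identityʳ 0#)))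
    cases (no r≢l) (no s≢l) (no l∉R) (no t≢l) =
      trans (H-outside l∉R (r≢l ∘ ≡.sym) (s≢l ∘ ≡.sym) (t≢l ∘ ≡.sym))
            (sym (trans (drop-K _) (+-identityʳ 0#)))

  ∑H-value : ∑ H ≈ H r + H r + - (½ * ∑∈ R K)
  ∑H-value = begin
    ∑ H
      ≈⟨ ∑-cong H-cases ⟩
    ∑ (λ l → when (does (r ≟ᶠ l)) (H r) + when (does (s ≟ᶠ l)) (H r) + - (½ * when (does (l ∈? R)) (K l)))
      ≈⟨ trans (∑-distrib-+ {n} _ _) (+-cong (∑-distrib-+ {n} _ _) (∑-neg {n} _)) ⟩
    ∑ (λ l → when (does (r ≟ᶠ l)) (H r)) + ∑ (λ l → when (does (s ≟ᶠ l)) (H r))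
      + - ∑ (λ l → ½ * when (does (l ∈? R)) (K l))
      ≈⟨ +-cong (+-cong (∑-δ r (λ _ → H r)) (∑-δ s (λ _ → H r))) (-‿cong (sym (*-distribˡ-∑ {n} ½ _))) ⟩
    H r + H r + - (½ * ∑∈ R K)
      ∎

  identity : ∑inj n (λ j → y z (j r) (j s) r * y z (j r) (j s) s * (p z j (R ∪ ⁅ t ⁆) - z~ z t * p z j R))
             ≈ ι (+ 2 / 1) * ι (recip N) * ∑inj n (λ j → Y j * y z (j t) (j r) t * p z j R)
               - ι (+ 1 / 2) * ι (recip N) * ∑∈ R K
  identity = begin
    ∑inj n (λ j → Y j * (p z j (R ∪ ⁅ t ⁆) - z~ z t * p z j R))  ≈⟨ ∑inj-cong′ n summand≈mean ⟩
    ∑inj n (λ j → I * ∑ (G j))                                 ≈⟨ *-distribˡ-∑inj n I _ ⟨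
    I * ∑inj n (λ j → ∑ (G j))                                 ≈⟨ *-congˡ (trans ∑G≈∑H ∑H-value) ⟩
    I * (H r + H r + - (½ * ∑∈ R K))                           ≈⟨ *-congˡ (+-congʳ (+-cong H-r H-r)) ⟩
    I * (D + D + - (½ * ∑∈ R K))
      ≈⟨ solve 3 (λ i x k → i :* (x :+ x :+ :- (con (+ 1 / 2) :* k)) := con (+ 2 / 1) :* i :* x :- con (+ 1 / 2) :* i :* k)
               refl I D (∑∈ R K) ⟩
    ι (+ 2 / 1) * I * D - ½ * I * ∑∈ R K                      ∎
    where
    I = ι (recip N)
    D = ∑inj n (λ j → Y j * y z (j t) (j r) t * p z j R)

lemma3p9 : ∀ {c ℓ : Level} (A : QAlgebra c ℓ) (N n : ℕ) → n ≤ N → 3 ≤ n →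
    (z : Fin N → Fin n → QAlgebra.Carrier A) →
    (R : Subset n) → ∣ R ∣ ≤ n ∸ 3 →
    (r s t : Fin n) → r ∉ R → s ∉ R → t ∉ R → r ≢ s → r ≢ t → s ≢ t →
    let open QAlgebra A
        open Ops A
        D₁ = ι (+ 2 / 1) * ι (recip N) *
               ∑inj n (λ j → y z (j r) (j s) r * y z (j r) (j s) s
                              * y z (j t) (j r) t * p z j R)
        D₂ = ι (+ 1 / 2) * ι (recip N) *
               ∑∈ R (λ q → ∑inj n (λ j → y z (j r) (j s) r * y z (j r) (j s) s
                              * y z (j t) (j q) t * y z (j t) (j q) q
                              * p z j (R -ₛ q)))
    in ∑inj n (λ j → y z (j r) (j s) r * y z (j r) (j s) s
                      * (p z j (R ∪ ⁅ t ⁆) - z~ z t * p z j R))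
       ≈ D₁ - D₂
lemma3p9 A zero n n≤N 3≤n z R _ r s t _ _ _ _ _ _ with ℕP.≤-trans 3≤n n≤N
... | ()
lemma3p9 A (suc m) n _ _ z R _ r s t r∉R s∉R t∉R r≢s r≢t s≢t =
  Identity.identity A z R r∉R s∉R t∉R r≢s r≢t s≢t
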